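{- Let $G$ be a finite abelian group and let $R\subseteq G$ be such that $R\neq R+H$ for every non-trivial subgroup $H$ of $G$. Then for any subsets $X,Y\subseteq G$ with $|X|=|G|-|R|$ and $|Y|\ge 2$, we have $(X+Y)\cap R\neq\emptyset$.
   Context: For subsets $S,S'\subseteq G$, $S+S'=\{s+s'\colon s\in S, s'\in S'\}$. -}

module Defs where

open import Level using (0ℓ)
open import Data.Nat using (ℕ)
open import Data.Fin using (Fin)
open import Data.Fin.Subset using (Subset; _∈_)
open import Data.Product using (Σ; ∃; ∃-syntax; _×_)
open import Relation.Binary.PropositionalEquality using (_≡_; _≢_)
open import Algebra.Core using (Op₁; Op₂)
open import Algebra.Structures using (IsAbelianGroup)

-- A finite abelian group of order n, realised on the carrier Fin n
-- (every finite group of order n is isomorphic to one on Fin n).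
record FinAbGroup (n : ℕ) : Set where
  field
    _+_ : Op₂ (Fin n)
    0g  : Fin n
    -_  : Op₁ (Fin n)
    isAbelianGroup : IsAbelianGroup _≡_ _+_ 0g -_

module _ {n : ℕ} (G : FinAbGroup n) where
  open FinAbGroup G

  InSumset : Subset n → Subset n → Fin n → Set
  InSumset S S' x = ∃[ s ] ∃[ s' ] (s ∈ S × s' ∈ S' × x ≡ s + s')

  IsSubgroup : Subset n → Set
  IsSubgroup H = (0g ∈ H)
               × (∀ {a b} → a ∈ H → b ∈ H → (a + b) ∈ H)
               × (∀ {a} → a ∈ H → (- a) ∈ H)

  NonTrivial : Subset n → Set
  NonTrivial H = ∃[ h ] (h ∈ H × h ≢ 0g)

  EqSumset : Subset n → Subset n → Set
  EqSumset R H = ∀ x → (x ∈ R → InSumset R H x) × (InSumset R H x → x ∈ R)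

{-# OPTIONS --safe #-}
-- If X + Y misses R, then for every y ∈ Y the translate X + y lies in the complement of R,
-- which has the same size as X; so X + y is the whole complement. Two distinct y₁, y₂ ∈ Y
-- thus give X + y₁ = X + y₂, i.e. the complement of R, and hence R itself, is invariant
-- under translation by d = y₂ − y₁ ≠ 0. Then R = R + H for the stabiliser H of R, a
-- subgroup containing d.
module Submission where

open import Defs
open import Level using (0ℓ)
open import Algebra.Bundles using (AbelianGroup)
open import Data.Bool.Properties using (T-≡)
open import Data.Fin.Base using (Fin; zero; suc)
open import Data.Fin.Properties using (_≟_; any?; all?; suc-injective)
open import Data.Fin.Subset using (Subset; _∈_; _∉_; _-_; ∣_∣; ⁅_⁆; inside; outside)
open import Data.Fin.Subset.Properties
  using (_∈?_; x∈p∧x≢y⇒x∈p-y; x∈p⇒∣p-x∣<∣p∣; x∉p⇒x∈∁p; ∣∁p∣≡n∸∣p∣;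
         p⊆q⇒∣p∣≤∣q∣; ∣⁅x⁆∣≡1; x∈⁅x⁆; nonempty?; Empty-unique; ∣⊥∣≡0)
open import Data.Nat.Base using (ℕ; _≤_; _∸_; _≥_; z≤n; s≤s)
open import Data.Nat.Properties using (≤-<-trans; ≤-trans; ≤-reflexive; ≤⇒≯)
open import Data.Product.Base using (∃-syntax; _×_; _,_; proj₁; proj₂)
open import Data.Vec.Base using (tabulate; []; _∷_; here; there)
open import Data.Vec.Properties using (lookup∘tabulate; []=⇒lookup; lookup⇒[]=)
open import Function.Base using (_∘_)
open import Function.Bundles using (Equivalence)
open import Function.Definitions using (Injective)
open import Relation.Binary.PropositionalEquality
  using (_≡_; _≢_; refl; sym; trans; cong; subst; module ≡-Reasoning)
open import Relation.Nullary using (¬_; yes; no; contradiction)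
open import Relation.Nullary.Decidable
  using (⌊_⌋; toWitness; fromWitness; decidable-stable; _×-dec_; _→-dec_; ¬?)
open import Relation.Unary using (Pred; Decidable)

private
  variable
    n m : ℕ

decSubset : {P : Pred (Fin n) 0ℓ} → Decidable P → Subset n
decSubset P? = tabulate (⌊_⌋ ∘ P?)

module _ {P : Pred (Fin n) 0ℓ} (P? : Decidable P) where

  ∈-decSubset⁺ : ∀ {x} → P x → x ∈ decSubset P?
  ∈-decSubset⁺ {x} px =
    lookup⇒[]= x _ (trans (lookup∘tabulate _ x) (Equivalence.to T-≡ (fromWitness px)))

  ∈-decSubset⁻ : ∀ {x} → x ∈ decSubset P? → P x
  ∈-decSubset⁻ {x} x∈ =
    toWitness {a? = P? x} (Equivalence.from T-≡ (trans (sym (lookup∘tabulate _ x)) ([]=⇒lookup x∈)))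

inj⇒∣p∣≤∣q∣ : (f : Fin n → Fin m) → Injective _≡_ _≡_ f →
              {p : Subset n} {q : Subset m} → (∀ {x} → x ∈ p → f x ∈ q) → ∣ p ∣ ≤ ∣ q ∣
inj⇒∣p∣≤∣q∣ f f-inj {[]}          f[p]⊆q = z≤n
inj⇒∣p∣≤∣q∣ f f-inj {outside ∷ p} f[p]⊆q =
  inj⇒∣p∣≤∣q∣ (f ∘ suc) (suc-injective ∘ f-inj) (f[p]⊆q ∘ there)
inj⇒∣p∣≤∣q∣ f f-inj {inside ∷ p} {q} f[p]⊆q = ≤-<-trans ∣p∣≤∣q-f0∣ (x∈p⇒∣p-x∣<∣p∣ (f[p]⊆q here))
  where
  ∣p∣≤∣q-f0∣ : ∣ p ∣ ≤ ∣ q - f zero ∣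
  ∣p∣≤∣q-f0∣ = inj⇒∣p∣≤∣q∣ (f ∘ suc) (suc-injective ∘ f-inj)
    (λ x∈p → x∈p∧x≢y⇒x∈p-y (f[p]⊆q (there x∈p)) (λ eq → contradiction (f-inj {_} {zero} eq) λ ()))

inj∧∣q∣≤∣p∣⇒onto : (f : Fin n → Fin m) → Injective _≡_ _≡_ f →
                   {p : Subset n} {q : Subset m} → (∀ {x} → x ∈ p → f x ∈ q) → ∣ q ∣ ≤ ∣ p ∣ →
                   ∀ {y} → y ∈ q → ∃[ x ] (x ∈ p × f x ≡ y)
inj∧∣q∣≤∣p∣⇒onto f f-inj {p} {q} f[p]⊆q ∣q∣≤∣p∣ {y} y∈q
  with any? (λ x → (x ∈? p) ×-dec (f x ≟ y))
... | yes hit = hit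
... | no miss = contradiction (x∈p⇒∣p-x∣<∣p∣ y∈q) (≤⇒≯ (≤-trans ∣q∣≤∣p∣ ∣p∣≤∣q-y∣))
  where
  ∣p∣≤∣q-y∣ : ∣ p ∣ ≤ ∣ q - y ∣
  ∣p∣≤∣q-y∣ = inj⇒∣p∣≤∣q∣ f f-inj
    (λ {x} x∈p → x∈p∧x≢y⇒x∈p-y (f[p]⊆q x∈p) (λ fx≡y → miss (x , x∈p , fx≡y)))

2≤∣p∣⇒two-distinct : {p : Subset n} → 2 ≤ ∣ p ∣ → ∃[ x ] ∃[ y ] (x ∈ p × y ∈ p × x ≢ y)
2≤∣p∣⇒two-distinct {n} {p} 2≤∣p∣ with nonempty? p
... | no empty = contradiction (subst (2 ≤_) (trans (cong ∣_∣ (Empty-unique empty)) (∣⊥∣≡0 n)) 2≤∣p∣) λ ()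
... | yes (x , x∈p) with any? (λ y → (y ∈? p) ×-dec ¬? (x ≟ y))
...   | yes (y , y∈p , x≢y) = x , y , x∈p , y∈p , x≢y
...   | no none =
  contradiction (≤-trans 2≤∣p∣ (subst (∣ p ∣ ≤_) (∣⁅x⁆∣≡1 x) (p⊆q⇒∣p∣≤∣q∣ p⊆⁅x⁆))) λ { (s≤s ()) }
  where
  p⊆⁅x⁆ : ∀ {y} → y ∈ p → y ∈ ⁅ x ⁆
  p⊆⁅x⁆ {y} y∈p = subst (_∈ ⁅ x ⁆) (decidable-stable (x ≟ y) (λ x≢y → none (y , y∈p , x≢y))) (x∈⁅x⁆ x)

module _ (G : FinAbGroup n) where
  open FinAbGroup G

  private
    abelianGroup : AbelianGroup 0ℓ 0ℓ
    abelianGroup = record { isAbelianGroup = isAbelianGroup }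

  open AbelianGroup abelianGroup using (assoc; identityʳ)
  open import Algebra.Properties.AbelianGroup abelianGroup
    using (∙-cancelʳ; //-rightDividesˡ; xyx⁻¹≈y; x∙y⁻¹≈ε⇒x≈y)

  +-shift : ∀ a y₁ y₂ → (a + y₁) + (y₂ + (- y₁)) ≡ a + y₂
  +-shift a y₁ y₂ = begin
    (a + y₁) + (y₂ + (- y₁))  ≡⟨ assoc a y₁ _ ⟩
    a + (y₁ + (y₂ + (- y₁)))  ≡⟨ cong (a +_) (sym (assoc y₁ y₂ _)) ⟩
    a + ((y₁ + y₂) + (- y₁))  ≡⟨ cong (a +_) (xyx⁻¹≈y y₁ y₂) ⟩
    a + y₂                    ∎
    where open ≡-Reasoning

  inSumset? : (S S′ : Subset n) → Decidable (InSumset G S S′)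
  inSumset? S S′ z = any? λ s → any? λ s′ → (s ∈? S) ×-dec (s′ ∈? S′) ×-dec (z ≟ s + s′)

  Stabilises : Subset n → Fin n → Set
  Stabilises R h = ∀ x → (x ∈ R → x + h ∈ R) × (x + h ∈ R → x ∈ R)

  stabilises? : (R : Subset n) → Decidable (Stabilises R)
  stabilises? R h = all? λ x → ((x ∈? R) →-dec (x + h ∈? R)) ×-dec ((x + h ∈? R) →-dec (x ∈? R))

  stabiliser : Subset n → Subset n
  stabiliser R = decSubset (stabilises? R)

  module _ (R : Subset n) where

    private
      stab⁺ : ∀ {h} → Stabilises R h → h ∈ stabiliser R
      stab⁺ = ∈-decSubset⁺ (stabilises? R)

      stab⁻ : ∀ {h} → h ∈ stabiliser R → Stabilises R h
      stab⁻ = ∈-decSubset⁻ (stabilises? R)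

    stabiliser-isSubgroup : IsSubgroup G (stabiliser R)
    stabiliser-isSubgroup =
        stab⁺ stabilises-0g
      , (λ a∈ b∈ → stab⁺ (stabilises-+ (stab⁻ a∈) (stab⁻ b∈)))
      , (λ a∈ → stab⁺ (stabilises-- (stab⁻ a∈)))
      where
      stabilises-0g : Stabilises R 0g
      stabilises-0g x = subst (_∈ R) (sym (identityʳ x)) , subst (_∈ R) (identityʳ x)

      stabilises-+ : ∀ {a b} → Stabilises R a → Stabilises R b → Stabilises R (a + b)
      stabilises-+ {a} {b} Sa Sb x =
          subst (_∈ R) (assoc x a b) ∘ proj₁ (Sb (x + a)) ∘ proj₁ (Sa x)
        , proj₂ (Sa x) ∘ proj₂ (Sb (x + a)) ∘ subst (_∈ R) (sym (assoc x a b))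

      stabilises-- : ∀ {a} → Stabilises R a → Stabilises R (- a)
      stabilises-- {a} Sa x =
          proj₂ (Sa (x + (- a))) ∘ subst (_∈ R) (sym (//-rightDividesˡ a x))
        , subst (_∈ R) (//-rightDividesˡ a x) ∘ proj₁ (Sa (x + (- a)))

    R≡R+stabiliser : EqSumset G R (stabiliser R)
    R≡R+stabiliser x =
        (λ x∈R → x , 0g , x∈R , proj₁ stabiliser-isSubgroup , sym (identityʳ x))
      , λ { (r , h , r∈R , h∈H , refl) → proj₁ (stab⁻ h∈H r) r∈R }

    translate-onto-complement : {X : Subset n} → ∣ X ∣ ≡ n ∸ ∣ R ∣ →
                                ∀ {y} → (∀ {a} → a ∈ X → a + y ∉ R) →
                                ∀ {x} → x ∉ R → ∃[ a ] (a ∈ X × a + y ≡ x)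
    translate-onto-complement ∣X∣≡n∸∣R∣ {y} X+y⊆∁R x∉R =
      inj∧∣q∣≤∣p∣⇒onto (_+ y) (∙-cancelʳ y _ _) (x∉p⇒x∈∁p ∘ X+y⊆∁R)
        (≤-reflexive (trans (∣∁p∣≡n∸∣p∣ R) (sym ∣X∣≡n∸∣R∣))) (x∉p⇒x∈∁p x∉R)

    disjoint-sumset⇒stabilises : {X Y : Subset n} → ∣ X ∣ ≡ n ∸ ∣ R ∣ →
                                 (∀ {z} → InSumset G X Y z → z ∉ R) →
                                 ∀ {y₁ y₂} → y₁ ∈ Y → y₂ ∈ Y → Stabilises R (y₂ + (- y₁))
    disjoint-sumset⇒stabilises {X} {Y} ∣X∣≡n∸∣R∣ X+Y∩R≡∅ {y₁} {y₂} y₁∈Y y₂∈Y x =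
        (λ x∈R → decidable-stable (x + d ∈? R) λ x+d∉R →
          let a , a∈X , a+y₂≡x+d = ∁R⊆X+ y₂∈Y x+d∉R
              x≡a+y₁ = ∙-cancelʳ d x (a + y₁) (trans (sym a+y₂≡x+d) (sym (+-shift a y₁ y₂)))
          in X+Y∩R≡∅ (a , y₁ , a∈X , y₁∈Y , x≡a+y₁) x∈R)
      , (λ x+d∈R → decidable-stable (x ∈? R) λ x∉R →
          let a , a∈X , a+y₁≡x = ∁R⊆X+ y₁∈Y x∉R
              x+d≡a+y₂ = trans (cong (_+ d) (sym a+y₁≡x)) (+-shift a y₁ y₂)
          in X+Y∩R≡∅ (a , y₂ , a∈X , y₂∈Y , x+d≡a+y₂) x+d∈R)
      where
      d : Fin n
      d = y₂ + (- y₁)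

      ∁R⊆X+ : ∀ {y} → y ∈ Y → ∀ {x} → x ∉ R → ∃[ a ] (a ∈ X × a + y ≡ x)
      ∁R⊆X+ y∈Y = translate-onto-complement ∣X∣≡n∸∣R∣ λ a∈X → X+Y∩R≡∅ (_ , _ , a∈X , y∈Y , refl)

    disjoint-sumset⇒nonTrivial-stabiliser : {X Y : Subset n} → ∣ X ∣ ≡ n ∸ ∣ R ∣ →
                                            (∀ {z} → InSumset G X Y z → z ∉ R) →
                                            ∀ {y₁ y₂} → y₁ ∈ Y → y₂ ∈ Y → y₁ ≢ y₂ →
                                            NonTrivial G (stabiliser R)
    disjoint-sumset⇒nonTrivial-stabiliser ∣X∣≡n∸∣R∣ X+Y∩R≡∅ {y₁} {y₂} y₁∈Y y₂∈Y y₁≢y₂ =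
        y₂ + (- y₁)
      , stab⁺ (disjoint-sumset⇒stabilises ∣X∣≡n∸∣R∣ X+Y∩R≡∅ y₁∈Y y₂∈Y)
      , λ d≡0 → y₁≢y₂ (sym (x∙y⁻¹≈ε⇒x≈y y₂ y₁ d≡0))

lemma4p8 : {n : ℕ} (G : FinAbGroup n) (R : Subset n) →
    (∀ (H : Subset n) → IsSubgroup G H → NonTrivial G H → ¬ EqSumset G R H) →
    ∀ (X Y : Subset n) → ∣ X ∣ ≡ n ∸ ∣ R ∣ → ∣ Y ∣ ≥ 2 →
    ∃[ z ] (InSumset G X Y z × z ∈ R)
lemma4p8 G R aperiodic X Y ∣X∣≡n∸∣R∣ ∣Y∣≥2
  with any? (λ z → inSumset? G X Y z ×-dec (z ∈? R))
... | yes z∈X+Y∩R = z∈X+Y∩R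
... | no X+Y∩R≡∅ =
  let y₁ , y₂ , y₁∈Y , y₂∈Y , y₁≢y₂ = 2≤∣p∣⇒two-distinct ∣Y∣≥2
      H≢0 = disjoint-sumset⇒nonTrivial-stabiliser G R ∣X∣≡n∸∣R∣
              (λ z∈X+Y z∈R → X+Y∩R≡∅ (_ , z∈X+Y , z∈R)) y₁∈Y y₂∈Y y₁≢y₂
  in contradiction (R≡R+stabiliser G R) (aperiodic (stabiliser G R) (stabiliser-isSubgroup G R) H≢0)
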